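{- For $n\ge 0$, $$P_{n+1}(x,y,z,w)=wP_n(x,y,z,w)+\sum_{k=0}^{n-1}\binom{n}{k}P_k(x,y,z,w)\,Q_{n-k}(x,y,z,w).$$
   Context: For a permutation $\pi=\pi_1\cdots\pi_n$ of $[n]=\{1,\dots,n\}$: an index $i$ is an exterior peak if either $i=1$ and $\pi_1>\pi_2$, or $1<i<n$ and $\pi_{i-1}<\pi_i>\pi_{i+1}$; an index $i$ is a proper double descent if $3\le i\le n$ and $\pi_{i-2}>\pi_{i-1}>\pi_i$. Let $P_n(i,j)$ be the number of permutations of $[n]$ with $i$ exterior peaks and $j$ proper double descents, and $P_n(x,y,z,w)=\sum_{i,j}P_n(i,j)x^iy^jz^{i+1}w^{n-2i-j}$ (so $P_0=z$, from the empty permutation). Further, setting $\pi_0=\pi_{n+1}=0$, for $1\le i\le n$ an index $i$ is a peak if $\pi_{i-1}<\pi_i>\pi_{i+1}$ and a double descent if $\pi_{i-1}>\pi_i>\pi_{i+1}$; let $Q_n(i,j)$ be the number of permutations of $[n]$ with $i$ peaks and $j$ double descents, and for $n\ge1$ let $Q_n(x,y,z,w)=\sum_{i,j}Q_n(i,j)x^iy^jz^iw^{n+1-2i-j}$. -}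

module Defs where

open import Level using (Level)
open import Data.Bool using (Bool; true; false; _∧_; if_then_else_)
open import Data.Nat using (ℕ; zero; suc; _∸_; _<ᵇ_; _≡ᵇ_)
open import Data.List using (List; []; _∷_; map; concatMap; filter; upTo; length)
import Data.Nat.Properties as ℕP
import Data.Nat as N
open import Data.List.Relation.Unary.Unique.DecPropositional ℕP._≟_ using (unique?)
open import Algebra.Bundles using (CommutativeSemiring)
import Algebra.Definitions.RawSemiring as RS

-- Permutations of [n] = {1,…,n}, as words π₁⋯πₙ (lists of naturals).

words : ℕ → ℕ → List (List ℕ)
words zero    k = [] ∷ []
words (suc m) k = concatMap (λ a → map (suc a ∷_) (words m k)) (upTo k)

perms : ℕ → List (List ℕ)
perms n = filter unique? (words n n)

-- 1-indexed access π_i; returns 0 outside 1..length (this realises π₀ = π_{n+1} = 0)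
at : List ℕ → ℕ → ℕ
at []      _             = 0
at (_ ∷ _) zero          = 0
at (a ∷ _) (suc zero)    = a
at (_ ∷ l) (suc (suc i)) = at l (suc i)

b2n : Bool → ℕ
b2n true  = 1
b2n false = 0

countIdx : ℕ → (ℕ → Bool) → ℕ
countIdx zero    p = 0
countIdx (suc n) p = countIdx n p N.+ b2n (p (suc n))

_<?_ : ℕ → ℕ → Bool
a <? b = a <ᵇ b

-- Statistics for P (no padding).

isExtPeak : List ℕ → ℕ → Bool
isExtPeak π i =
  let n = length π in
  ((i ≡ᵇ 1) ∧ (1 <ᵇ n) ∧ (at π 2 <? at π 1))
  ∨' ((1 <ᵇ i) ∧ (i <ᵇ n) ∧ (at π (i ∸ 1) <? at π i) ∧ (at π (i N.+ 1) <? at π i))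
  where
  _∨'_ : Bool → Bool → Bool
  true  ∨' _ = true
  false ∨' b = b

isProperDD : List ℕ → ℕ → Bool
isProperDD π i =
  (2 <ᵇ i) ∧ (at π (i ∸ 1) <? at π (i ∸ 2)) ∧ (at π i <? at π (i ∸ 1))

extPk : List ℕ → ℕ
extPk π = countIdx (length π) (isExtPeak π)

pdd : List ℕ → ℕ
pdd π = countIdx (length π) (isProperDD π)

-- Statistics for Q (with π₀ = π_{n+1} = 0).

isPeak : List ℕ → ℕ → Bool
isPeak π i = (at π (i ∸ 1) <? at π i) ∧ (at π (i N.+ 1) <? at π i)

isDD : List ℕ → ℕ → Bool
isDD π i = (at π i <? at π (i ∸ 1)) ∧ (at π (i N.+ 1) <? at π i)

pk : List ℕ → ℕ
pk π = countIdx (length π) (isPeak π)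

dd : List ℕ → ℕ
dd π = countIdx (length π) (isDD π)

-- The generating polynomials, evaluated in an arbitrary commutative
-- semiring (an identity of polynomials in ℕ[x,y,z,w] holds iff it holds
-- for all evaluations in all commutative semirings).

module Poly {c ℓ : Level} (R : CommutativeSemiring c ℓ) where
  open CommutativeSemiring R
  open RS rawSemiring using (_^_)

  Σl : {A : Set} → (A → Carrier) → List A → Carrier
  Σl f []       = 0#
  Σl f (a ∷ as) = f a + Σl f as

  Σ< : ℕ → (ℕ → Carrier) → Carrier
  Σ< zero    f = 0#
  Σ< (suc m) f = Σ< m f + f m

  nat : ℕ → Carrier
  nat zero    = 0#
  nat (suc k) = 1# + nat k

  P : ℕ → Carrier → Carrier → Carrier → Carrier → Carrier
  P n x y z w = Σl (λ π → (x ^ extPk π) * (y ^ pdd π) * (z ^ (extPk π N.+ 1))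
                          * (w ^ (n ∸ (2 N.* extPk π N.+ pdd π)))) (perms n)

  -- Q_n(x,y,z,w) = Σ_π x^{pk} y^{dd} z^{pk} w^{n+1-2 pk-dd}   (used for n ≥ 1)
  Q : ℕ → Carrier → Carrier → Carrier → Carrier → Carrier
  Q n x y z w = Σl (λ π → (x ^ pk π) * (y ^ dd π) * (z ^ pk π)
                          * (w ^ ((n N.+ 1) ∸ (2 N.* pk π N.+ dd π)))) (perms n)

module Submission where

open import Defs
open import Data.Nat using (ℕ; suc; _∸_)
open import Data.Nat.Combinatorics using (_C_)
open import Algebra.Bundles using (CommutativeSemiring)

-- The recurrence  P_{n+1} = w P_n + Σ_{k<n} C(n,k) P_k Q_{n-k}  is proved by
-- locating the letter 1 in a permutation of [n+1].
--
-- A word π₁⋯πₙ is encoded by its descent word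
--   d₁⋯dₙ with dᵢ = [πᵢ > πᵢ₊₁] and dₙ = false; "marking" sets dₙ = true,
--   which models the padding π_{n+1} = 0.  Reading d with d₀ = false, the
--   exterior peaks / peaks are the patterns (false,true), the (proper) double
--   descents are (true,true), and the exponent of w counts the double ascents
--   (false,false).  So P_n and Q_n are sums over perms n of weights of
--   (marked) descent words.
-- * Permutations.  perms (n+1) is a rearrangement of the list of all words
--   obtained by inserting 1 at a position j ≤ n into a shifted permutation of
--   [n]; inserting the minimum changes the descent word in a controlled way.
-- * Sums, DescentSums.  Finite sums in a commutative semiring; the shuffle
--   lemma Σ_{π ∈ perms n} F(d(π₁⋯π_k))·G(d(π_{k+1}⋯πₙ)) = C(n,k)·ΣF·ΣG,
--   itself proved by locating 1 before or after the cut.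
-- * Weights.  Putting 1 first contributes w·P_n.  Putting 1 after i+1 letters
--   cuts π = σ 1 τ, whose weight is weightQ(σ)·weightP(τ); by the shuffle
--   lemma these sum to C(n,i+1)·Q_{i+1}·P_{n-i-1}.  Reindexing i ↦ n-1-i gives
--   the theorem.

module DescentWords where

  open import Data.Nat using (ℕ; zero; suc; _+_; _*_; _∸_; _<ᵇ_; _≤_; _<_; z≤n; s≤s)
  open import Data.Nat.Properties
  open import Data.Nat.Solver using (module +-*-Solver)
  open import Data.Bool using (Bool; true; false; not; _∧_; T)
  open import Data.Unit using (tt)
  open import Data.List using (List; []; _∷_; _++_; map; take; drop; length)
  open import Data.List.Relation.Unary.All using (All; []; _∷_)
  open import Relation.Binary.PropositionalEquality
  open import Data.Empty using (⊥-elim)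
  open import Relation.Binary.Definitions using (tri<; tri≈; tri>)

  <ᵇ-true : ∀ {m n} → m < n → (m <ᵇ n) ≡ true
  <ᵇ-true {m} {n} p with m <ᵇ n | <⇒<ᵇ p
  ... | true | _ = refl

  <ᵇ-false : ∀ {m n} → n ≤ m → (m <ᵇ n) ≡ false
  <ᵇ-false {m} {n} p with m <ᵇ n in eq
  ... | false = refl
  ... | true = ⊥-elim (<⇒≱ (<ᵇ⇒< m n (subst T (sym eq) tt)) p)

  <ᵇ-flip : ∀ a b → a ≢ b → (a <ᵇ b) ≡ not (b <ᵇ a)
  <ᵇ-flip a b ne with <-cmp a b
  ... | tri< p _ _ = trans (<ᵇ-true p) (cong not (sym (<ᵇ-false (<⇒≤ p))))
  ... | tri≈ _ e _ = ⊥-elim (ne e)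
  ... | tri> _ _ p = trans (<ᵇ-false (<⇒≤ p)) (cong not (sym (<ᵇ-true p)))

  firstDescent : ℕ → List ℕ → Bool
  firstDescent a []      = false
  firstDescent a (b ∷ _) = b <ᵇ a

  descents : List ℕ → List Bool
  descents []          = []
  descents (a ∷ [])    = false ∷ []
  descents (a ∷ b ∷ l) = (b <ᵇ a) ∷ descents (b ∷ l)

  descents-∷ : ∀ a l → descents (a ∷ l) ≡ firstDescent a l ∷ descents l
  descents-∷ a []      = refl
  descents-∷ a (b ∷ l) = refl

  length-descents : ∀ l → length (descents l) ≡ length l
  length-descents []      = refl
  length-descents (a ∷ l) = trans (cong length (descents-∷ a l)) (cong suc (length-descents l))

  -- Descent words only depend on the relative order of the letters.
  descents-map-suc : ∀ l → descents (map suc l) ≡ descents l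
  descents-map-suc []          = refl
  descents-map-suc (a ∷ [])    = refl
  descents-map-suc (a ∷ b ∷ l) = cong ((b <ᵇ a) ∷_) (descents-map-suc (b ∷ l))

  -- Setting the last bit to true: the descent word for the padding π_{n+1} = 0.
  markLast : List Bool → List Bool
  markLast []          = []
  markLast (b ∷ [])    = true ∷ []
  markLast (b ∷ c ∷ u) = b ∷ markLast (c ∷ u)

  length-markLast : ∀ u → length (markLast u) ≡ length u
  length-markLast []          = refl
  length-markLast (b ∷ [])    = refl
  length-markLast (b ∷ c ∷ u) = cong suc (length-markLast (c ∷ u))

  lastBit : Bool → List Bool → Bool
  lastBit b []      = b
  lastBit b (c ∷ u) = lastBit c u

  lastBit-descents : ∀ b a l → lastBit b (descents (a ∷ l)) ≡ false
  lastBit-descents b a []      = refl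
  lastBit-descents b a (c ∷ l) = lastBit-descents (c <ᵇ a) c l

  lastBit-markLast : ∀ b c u → lastBit b (markLast (c ∷ u)) ≡ true
  lastBit-markLast b c []      = refl
  lastBit-markLast b c (d ∷ u) = lastBit-markLast c d u

  -- Patterns of two consecutive bits (d_{i-1}, d_i): a peak is an ascent
  -- followed by a descent, a valley the reverse; double descents / ascents.
  peakPat valleyPat ddPat daPat : Bool → Bool → Bool
  peakPat   b c = not b ∧ c
  valleyPat b c = b ∧ not c
  ddPat     b c = b ∧ c
  daPat     b c = not b ∧ not c

  countPat : (Bool → Bool → Bool) → Bool → List Bool → ℕ
  countPat p b []      = 0
  countPat p b (c ∷ u) = b2n (p b c) + countPat p c u

  countPat-++ : ∀ p b u c v →
    countPat p b (u ++ c ∷ v) ≡ countPat p b u + (b2n (p (lastBit b u) c) + countPat p c v)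
  countPat-++ p b []      c v = refl
  countPat-++ p b (d ∷ u) c v =
    trans (cong (b2n (p b d) +_) (countPat-++ p d u c v)) (sym (+-assoc (b2n (p b d)) _ _))

  countPat-total : ∀ b u →
    countPat peakPat b u + countPat valleyPat b u + countPat ddPat b u + countPat daPat b u ≡ length u
  countPat-total b []      = refl
  countPat-total b (c ∷ u) with countPat-total c u
  ... | ih with b | c
  ... | true  | true  = trans (shift (countPat peakPat true u) _ _ _) (cong suc ih)
    where
    shift : ∀ a b c d → a + b + suc c + d ≡ suc (a + b + c + d)
    shift a b c d rewrite +-suc (a + b) c = refl
  ... | true  | false = trans (shift (countPat peakPat false u) _ _ _) (cong suc ih)
    where
    shift : ∀ a b c d → a + suc b + c + d ≡ suc (a + b + c + d)
    shift a b c d rewrite +-suc a b = refl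
  ... | false | true  = cong suc ih
  ... | false | false = trans (+-suc _ _) (cong suc ih)

  -- Peaks and valleys alternate: #peaks + [d₀] = #valleys + [last bit].
  countPat-balance : ∀ b u → countPat peakPat b u + b2n b ≡ countPat valleyPat b u + b2n (lastBit b u)
  countPat-balance b []      = refl
  countPat-balance b (c ∷ u) with countPat-balance c u
  ... | ih with b | c
  ... | true  | true  = ih
  ... | true  | false = trans (+-comm (countPat peakPat false u) 1)
                              (cong suc (trans (sym (+-identityʳ _)) ih))
  ... | false | true  = trans (+-identityʳ _) (trans (+-comm 1 (countPat peakPat true u)) ih)
  ... | false | false = ih

  countPat-cut : ∀ p → p true false ≡ false → ∀ b u v → lastBit b u ≡ true →
    countPat p b (u ++ false ∷ v) ≡ countPat p b u + countPat p false v
  countPat-cut p p-cut b u v last rewrite countPat-++ p b u false v | last | p-cut = refl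

  peaks doubleDescents doubleAscents : List Bool → ℕ
  peaks          = countPat peakPat false
  doubleDescents = countPat ddPat false
  doubleAscents  = countPat daPat false

  -- Combining the two counts: the exponent of w in P_n / Q_n is the number
  -- of double ascents of the (marked) descent word.
  doubleAscents-exponent : ∀ u →
    (length u + b2n (lastBit false u)) ∸ (2 * peaks u + doubleDescents u) ≡ doubleAscents u
  doubleAscents-exponent u =
    trans (cong (_∸ (2 * p + t)) length+last) (m+n∸m≡n (2 * p + t) d)
    where
    open ≡-Reasoning
    open +-*-Solver
    p = peaks u
    v = countPat valleyPat false u
    t = doubleDescents u
    d = doubleAscents u
    l = b2n (lastBit false u)
    length+last : length u + l ≡ 2 * p + t + d
    length+last = begin
      length u + l            ≡⟨ cong (_+ l) (sym (countPat-total false u)) ⟩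
      p + v + t + d + l       ≡⟨ solve 5 (λ p v t d l → p :+ v :+ t :+ d :+ l := p :+ (v :+ l) :+ t :+ d) refl p v t d l ⟩
      p + (v + l) + t + d     ≡⟨ cong (λ q → p + q + t + d) (sym (countPat-balance false u)) ⟩
      p + (p + 0) + t + d     ≡⟨ solve 3 (λ p t d → p :+ (p :+ con 0) :+ t :+ d := con 2 :* p :+ t :+ d) refl p t d ⟩
      2 * p + t + d           ∎

  insertAt : ℕ → ℕ → List ℕ → List ℕ
  insertAt zero    m l       = m ∷ l
  insertAt (suc j) m []      = m ∷ []
  insertAt (suc j) m (a ∷ l) = a ∷ insertAt j m l

  insertAt-split : ∀ j m s → insertAt j m s ≡ take j s ++ m ∷ drop j s
  insertAt-split zero    m s       = refl
  insertAt-split (suc j) m []      = refl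
  insertAt-split (suc j) m (a ∷ s) = cong (a ∷_) (insertAt-split j m s)

  take-insertAt-≤ : ∀ j k m s → j ≤ k → take (suc k) (insertAt j m s) ≡ insertAt j m (take k s)
  take-insertAt-≤ zero    k       m s       _        = refl
  take-insertAt-≤ (suc j) (suc k) m []      _        = refl
  take-insertAt-≤ (suc j) (suc k) m (a ∷ s) (s≤s le) = cong (a ∷_) (take-insertAt-≤ j k m s le)

  drop-insertAt-≤ : ∀ j k m s → j ≤ k → drop (suc k) (insertAt j m s) ≡ drop k s
  drop-insertAt-≤ zero    k       m s       _        = refl
  drop-insertAt-≤ (suc j) (suc k) m []      _        = refl
  drop-insertAt-≤ (suc j) (suc k) m (a ∷ s) (s≤s le) = drop-insertAt-≤ j k m s le

  take-insertAt-≥ : ∀ k i m s → k ≤ length s → take k (insertAt (k + i) m s) ≡ take k s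
  take-insertAt-≥ zero    i m s       _        = refl
  take-insertAt-≥ (suc k) i m (a ∷ s) (s≤s le) = cong (a ∷_) (take-insertAt-≥ k i m s le)

  drop-insertAt-≥ : ∀ k i m s → k ≤ length s → drop k (insertAt (k + i) m s) ≡ insertAt i m (drop k s)
  drop-insertAt-≥ zero    i m s       _        = refl
  drop-insertAt-≥ (suc k) i m (a ∷ s) (s≤s le) = drop-insertAt-≥ k i m s le

  -- The descent word after inserting the least letter at position j: the bit
  -- before it becomes a descent, and the new letter itself is an ascent.
  insertBit : ℕ → List Bool → List Bool
  insertBit zero          u       = false ∷ u
  insertBit (suc zero)    (b ∷ u) = true ∷ false ∷ u
  insertBit (suc (suc j)) (b ∷ u) = b ∷ insertBit (suc j) u
  insertBit (suc j)       []      = []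

  firstDescent-min : ∀ s → All (1 <_) s → firstDescent 1 s ≡ false
  firstDescent-min []      _       = refl
  firstDescent-min (a ∷ s) (p ∷ _) = <ᵇ-false (<⇒≤ p)

  descents-insertMin : ∀ j s → All (1 <_) s → j ≤ length s →
    descents (insertAt j 1 s) ≡ insertBit j (descents s)
  descents-insertMin zero [] _ _ = refl
  descents-insertMin zero (a ∷ s) (p ∷ _) _ =
    trans (descents-∷ 1 (a ∷ s)) (cong (_∷ descents (a ∷ s)) (<ᵇ-false (<⇒≤ p)))
  descents-insertMin (suc zero) (a ∷ s) (p ∷ ps) _ =
    trans (descents-∷ a (1 ∷ s))
          (trans (cong₂ _∷_ (<ᵇ-true p) (descents-insertMin zero s ps z≤n))
                 (cong (insertBit 1) (sym (descents-∷ a s))))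
  descents-insertMin (suc (suc j)) (a ∷ c ∷ s) (p ∷ ps) (s≤s le) =
    trans (descents-∷ a (c ∷ insertAt j 1 s))
          (trans (cong ((c <ᵇ a) ∷_) (descents-insertMin (suc j) (c ∷ s) ps le))
                 (cong (insertBit (suc (suc j))) (sym (descents-∷ a (c ∷ s)))))

  -- Cutting π = σ 1 τ at the least letter: the descent word of σ gets its
  -- last bit marked (σ ends with a descent into 1), and 1 starts with an ascent.
  descents-cut : ∀ a σ τ → All (1 <_) (a ∷ σ) → All (1 <_) τ →
    descents ((a ∷ σ) ++ 1 ∷ τ) ≡ markLast (descents (a ∷ σ)) ++ false ∷ descents τ
  descents-cut a [] τ (p ∷ _) q =
    cong₂ _∷_ (<ᵇ-true p) (trans (descents-∷ 1 τ) (cong (_∷ descents τ) (firstDescent-min τ q)))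
  descents-cut a (b ∷ σ) τ (p ∷ ps) q =
    trans (cong ((b <ᵇ a) ∷_) (descents-cut b σ τ ps q))
          (cong (_++ false ∷ descents τ) (markLast-∷ (b <ᵇ a) b σ))
    where
    markLast-∷ : ∀ x b σ → x ∷ markLast (descents (b ∷ σ)) ≡ markLast (x ∷ descents (b ∷ σ))
    markLast-∷ x b σ rewrite descents-∷ b σ = refl


module Statistics where

  open import Data.Nat using (ℕ; zero; suc; _+_; _∸_; _<ᵇ_; _≤_; _<_; z≤n; s≤s)
  open import Data.Nat.Properties
  open import Data.Bool using (Bool; true; false; _∧_)
  open import Data.Bool.Properties using (∧-zeroʳ; ∧-identityʳ)
  open import Data.List using (List; []; _∷_; length)
  open import Data.Sum using (inj₁; inj₂)
  open import Relation.Binary.PropositionalEquality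
  open DescentWords

  AdjacentDistinct : List ℕ → Set
  AdjacentDistinct π = ∀ k → suc (suc k) ≤ length π → at π (suc k) ≢ at π (suc (suc k))

  Positive : List ℕ → Set
  Positive π = ∀ k → suc k ≤ length π → 0 < at π (suc k)

  bitAt : Bool → List Bool → ℕ → Bool
  bitAt b u       zero    = b
  bitAt b []      (suc i) = false
  bitAt b (c ∷ u) (suc i) = bitAt c u i

  patternAt : (Bool → Bool → Bool) → List Bool → ℕ → Bool
  patternAt p u i = p (bitAt false u (i ∸ 1)) (bitAt false u i)

  countIdx-shift : ∀ n q → countIdx (suc n) q ≡ b2n (q 1) + countIdx n (λ i → q (suc i))
  countIdx-shift zero    q = +-comm 0 (b2n (q 1))
  countIdx-shift (suc n) q =
    trans (cong (_+ b2n (q (suc (suc n)))) (countIdx-shift n q))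
          (+-assoc (b2n (q 1)) (countIdx n (λ i → q (suc i))) (b2n (q (suc (suc n)))))

  countIdx-cong : ∀ n p q → (∀ i → 1 ≤ i → i ≤ n → p i ≡ q i) → countIdx n p ≡ countIdx n q
  countIdx-cong zero    p q h = refl
  countIdx-cong (suc n) p q h =
    cong₂ _+_ (countIdx-cong n p q (λ i a b → h i a (m≤n⇒m≤1+n b))) (cong b2n (h (suc n) (s≤s z≤n) ≤-refl))

  countPat-countIdx : ∀ p b u → countPat p b u ≡ countIdx (length u) (λ i → p (bitAt b u (i ∸ 1)) (bitAt b u i))
  countPat-countIdx p b []      = refl
  countPat-countIdx p b (c ∷ u) =
    trans (cong (b2n (p b c) +_) (trans (countPat-countIdx p c u)
             (countIdx-cong (length u) _ _ (λ { (suc i) _ _ → refl }))))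
          (sym (countIdx-shift (length u) (λ i → p (bitAt b (c ∷ u) (i ∸ 1)) (bitAt b (c ∷ u) i))))

  countIdx-pattern : ∀ p u n q → length u ≡ n → (∀ i → 1 ≤ i → i ≤ n → q i ≡ patternAt p u i) →
    countIdx n q ≡ countPat p false u
  countIdx-pattern p u n q len h =
    trans (countIdx-cong n q (patternAt p u) h)
          (sym (trans (countPat-countIdx p false u) (cong (λ m → countIdx m (patternAt p u)) len)))

  bitAt-descents : ∀ π b k → suc (suc k) ≤ length π →
    bitAt b (descents π) (suc k) ≡ (at π (suc (suc k)) <ᵇ at π (suc k))
  bitAt-descents (a ∷ [])    b k       (s≤s ())
  bitAt-descents (a ∷ c ∷ l) b zero    _        = refl
  bitAt-descents (a ∷ c ∷ l) b (suc k) (s≤s le) = bitAt-descents (c ∷ l) (c <ᵇ a) k le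

  bitAt-descents-end : ∀ a l b → bitAt b (descents (a ∷ l)) (length (a ∷ l)) ≡ false
  bitAt-descents-end a []      b = refl
  bitAt-descents-end a (c ∷ l) b = bitAt-descents-end c l (c <ᵇ a)

  bitAt-markLast : ∀ b u k → suc (suc k) ≤ length u → bitAt b (markLast u) (suc k) ≡ bitAt b u (suc k)
  bitAt-markLast b (c ∷ [])    k       (s≤s ())
  bitAt-markLast b (c ∷ d ∷ u) zero    _        = refl
  bitAt-markLast b (c ∷ d ∷ u) (suc k) (s≤s le) = bitAt-markLast c (d ∷ u) k le

  bitAt-markLast-end : ∀ b c u → bitAt b (markLast (c ∷ u)) (length (c ∷ u)) ≡ true
  bitAt-markLast-end b c []      = refl
  bitAt-markLast-end b c (d ∷ u) = bitAt-markLast-end c d u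

  bitAt-markLast-descents : ∀ π b k → suc (suc k) ≤ length π →
    bitAt b (markLast (descents π)) (suc k) ≡ (at π (suc (suc k)) <ᵇ at π (suc k))
  bitAt-markLast-descents π b k le =
    trans (bitAt-markLast b (descents π) k (subst (suc (suc k) ≤_) (sym (length-descents π)) le))
          (bitAt-descents π b k le)

  bitAt-descents-last : ∀ π b i → 1 ≤ i → i ≡ length π → bitAt b (descents π) i ≡ false
  bitAt-descents-last (a ∷ l) b i _ refl = bitAt-descents-end a l b

  bitAt-markLast-last : ∀ π b i → 1 ≤ i → i ≡ length π → bitAt b (markLast (descents π)) i ≡ true
  bitAt-markLast-last (a ∷ l) b i _ refl rewrite descents-∷ a l =
    subst (λ n → bitAt b (markLast (firstDescent a l ∷ descents l)) (suc n) ≡ true)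
          (length-descents l) (bitAt-markLast-end b (firstDescent a l) (descents l))

  at-beyond : ∀ π i → i ≡ length π → at π (suc i) ≡ 0
  at-beyond []          _ refl = refl
  at-beyond (a ∷ [])    _ refl = refl
  at-beyond (a ∷ c ∷ l) _ refl = at-beyond (c ∷ l) _ refl

  at-zero : ∀ π → at π 0 ≡ 0
  at-zero []      = refl
  at-zero (_ ∷ _) = refl

  isExtPeak-pattern : ∀ π → AdjacentDistinct π → ∀ i → 1 ≤ i → i ≤ length π →
    isExtPeak π i ≡ patternAt peakPat (descents π) i
  isExtPeak-pattern (a ∷ [])    adj (suc zero) _ _ = refl
  isExtPeak-pattern (a ∷ c ∷ l) adj (suc zero) _ _ with c <ᵇ a
  ... | true  = refl
  ... | false = refl
  isExtPeak-pattern π adj (suc (suc k)) _ le with m≤n⇒m<n∨m≡n le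
  ... | inj₁ lt rewrite <ᵇ-true lt | bitAt-descents π false k le | bitAt-descents π false (suc k) lt | +-comm k 1 =
    cong (_∧ (at π (suc (suc (suc k))) <ᵇ at π (suc (suc k)))) (<ᵇ-flip _ _ (adj k le))
  ... | inj₂ eq rewrite <ᵇ-false {suc (suc k)} {length π} (≤-reflexive (sym eq))
                      | bitAt-descents-last π false (suc (suc k)) (s≤s z≤n) eq = sym (∧-zeroʳ _)

  extPk≡peaks : ∀ π → AdjacentDistinct π → extPk π ≡ peaks (descents π)
  extPk≡peaks π adj =
    countIdx-pattern peakPat (descents π) (length π) (isExtPeak π) (length-descents π) (isExtPeak-pattern π adj)

  isProperDD-pattern : ∀ π i → 1 ≤ i → suc i ≤ length π →
    isProperDD π (suc i) ≡ patternAt ddPat (descents π) i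
  isProperDD-pattern π (suc zero)    _ _  = refl
  isProperDD-pattern π (suc (suc k)) _ lt
    rewrite bitAt-descents π false k (≤-trans (n≤1+n _) lt) | bitAt-descents π false (suc k) lt = refl

  pdd≡doubleDescents : ∀ π → pdd π ≡ doubleDescents (descents π)
  pdd≡doubleDescents []      = refl
  pdd≡doubleDescents (a ∷ l) = begin
    pdd (a ∷ l)
      ≡⟨ countIdx-shift (length l) (isProperDD (a ∷ l)) ⟩
    countIdx (length l) (λ i → isProperDD (a ∷ l) (suc i))
      ≡⟨ countIdx-cong (length l) _ _ (λ i p q → isProperDD-pattern (a ∷ l) i p (s≤s q)) ⟩
    countIdx (length l) (patternAt ddPat u)
      ≡⟨ sym (+-identityʳ _) ⟩
    countIdx (length l) (patternAt ddPat u) + 0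
      ≡⟨ cong (λ b → countIdx (length l) (patternAt ddPat u) + b2n b) (sym lastPattern) ⟩
    countIdx (length (a ∷ l)) (patternAt ddPat u)
      ≡⟨ countIdx-pattern ddPat u (length (a ∷ l)) (patternAt ddPat u) (length-descents (a ∷ l)) (λ _ _ _ → refl) ⟩
    doubleDescents u ∎
    where
    open ≡-Reasoning
    u = descents (a ∷ l)
    -- the last bit is an ascent, so no double descent ends there
    lastPattern : patternAt ddPat u (length (a ∷ l)) ≡ false
    lastPattern = trans (cong (ddPat _) (bitAt-descents-end a l false)) (∧-zeroʳ _)

  isPeak-pattern : ∀ π → AdjacentDistinct π → Positive π → ∀ i → 1 ≤ i → i ≤ length π →
    isPeak π i ≡ patternAt peakPat (markLast (descents π)) i
  isPeak-pattern π adj pos (suc zero) _ le rewrite at-zero π | <ᵇ-true (pos 0 le) with m≤n⇒m<n∨m≡n le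
  ... | inj₁ lt rewrite bitAt-markLast-descents π false 0 lt = refl
  ... | inj₂ eq rewrite at-beyond π 1 eq | <ᵇ-true (pos 0 le) = sym (bitAt-markLast-last π false 1 (s≤s z≤n) eq)
  isPeak-pattern π adj pos (suc (suc k)) _ le with m≤n⇒m<n∨m≡n le
  ... | inj₁ lt rewrite bitAt-markLast-descents π false k le | bitAt-markLast-descents π false (suc k) lt | +-comm k 1 =
    cong (_∧ (at π (suc (suc (suc k))) <ᵇ at π (suc (suc k)))) (<ᵇ-flip _ _ (adj k le))
  ... | inj₂ eq rewrite bitAt-markLast-descents π false k le
                      | bitAt-markLast-last π false (suc (suc k)) (s≤s z≤n) eq
                      | +-comm k 1
                      | at-beyond π (suc (suc k)) eq
                      | <ᵇ-true (pos (suc k) le) =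
    trans (∧-identityʳ _) (trans (<ᵇ-flip _ _ (adj k le)) (sym (∧-identityʳ _)))

  isDD-pattern : ∀ π → Positive π → ∀ i → 1 ≤ i → i ≤ length π →
    isDD π i ≡ patternAt ddPat (markLast (descents π)) i
  isDD-pattern π pos (suc zero) _ le rewrite at-zero π = refl
  isDD-pattern π pos (suc (suc k)) _ le with m≤n⇒m<n∨m≡n le
  ... | inj₁ lt rewrite bitAt-markLast-descents π false k le | bitAt-markLast-descents π false (suc k) lt | +-comm k 1 = refl
  ... | inj₂ eq rewrite bitAt-markLast-descents π false k le
                      | bitAt-markLast-last π false (suc (suc k)) (s≤s z≤n) eq
                      | +-comm k 1
                      | at-beyond π (suc (suc k)) eq
                      | <ᵇ-true (pos (suc k) le) = refl

  length-markLast-descents : ∀ π → length (markLast (descents π)) ≡ length π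
  length-markLast-descents π = trans (length-markLast (descents π)) (length-descents π)

  pk≡peaks : ∀ π → AdjacentDistinct π → Positive π → pk π ≡ peaks (markLast (descents π))
  pk≡peaks π adj pos =
    countIdx-pattern peakPat _ (length π) (isPeak π) (length-markLast-descents π) (isPeak-pattern π adj pos)

  dd≡doubleDescents : ∀ π → Positive π → dd π ≡ doubleDescents (markLast (descents π))
  dd≡doubleDescents π pos =
    countIdx-pattern ddPat _ (length π) (isDD π) (length-markLast-descents π) (isDD-pattern π pos)

module Permutations where

  open import Data.Nat using (ℕ; zero; suc; _≤_; _<_; z≤n; s≤s; s≤s⁻¹; pred)
  open import Data.Nat.Properties
  open import Data.List using (List; []; _∷_; _++_; map; length; upTo; concatMap)
  open import Data.List.Properties using (length-map; length-++; length-++-sucʳ; map-injective)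
  open import Data.List.Relation.Unary.All as All using (All; []; _∷_)
  import Data.List.Relation.Unary.All.Properties as AllP
  open import Data.List.Relation.Unary.AllPairs using ([]; _∷_)
  open import Data.List.Relation.Unary.Unique.Propositional using (Unique)
  open import Data.List.Relation.Unary.Unique.Propositional.Properties using (map⁺; ++⁺; filter⁺; upTo⁺)
  open import Data.List.Relation.Unary.Unique.DecPropositional _≟_ using (unique?)
  open import Data.List.Relation.Unary.Any using (here; there)
  open import Data.List.Membership.Propositional using (_∈_; _∉_; find; lose)
  open import Data.List.Membership.Propositional.Properties
  open import Data.List.Membership.Propositional.Properties.WithK using (unique∧set⇒bag)
  open import Data.List.Membership.DecPropositional _≟_ using (_∈?_)
  open import Data.List.Relation.Binary.Disjoint.Propositional using (Disjoint)
  open import Data.List.Relation.Binary.BagAndSetEquality using (∼bag⇒↭)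
  open import Data.List.Relation.Binary.Permutation.Propositional using (_↭_)
  open import Data.Product using (_×_; _,_; proj₁; proj₂)
  open import Relation.Binary.PropositionalEquality
  open import Relation.Nullary using (yes; no)
  open import Data.Empty using (⊥-elim)
  open import Function using (_∘_)
  open import Function.Bundles using (mk⇔)
  open DescentWords using (insertAt)
  open Statistics using (AdjacentDistinct; Positive)

  InRange : ℕ → ℕ → Set
  InRange k a = 1 ≤ a × a ≤ k

  IsPerm : ℕ → List ℕ → Set
  IsPerm n π = Unique π × length π ≡ n × All (InRange n) π

  unique⇒adjacentDistinct : ∀ π → Unique π → AdjacentDistinct π
  unique⇒adjacentDistinct (a ∷ [])    _              k       (s≤s ())
  unique⇒adjacentDistinct (a ∷ c ∷ l) ((pa ∷ _) ∷ _) zero    _        = pa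
  unique⇒adjacentDistinct (a ∷ c ∷ l) (_ ∷ u)        (suc k) (s≤s le) = unique⇒adjacentDistinct (c ∷ l) u k le

  inRange⇒positive : ∀ {n} π → All (InRange n) π → Positive π
  inRange⇒positive (a ∷ l)     ((p , _) ∷ _) zero    _        = p
  inRange⇒positive (a ∷ [])    _             (suc k) (s≤s ())
  inRange⇒positive (a ∷ c ∷ l) (_ ∷ ps)      (suc k) (s≤s le) = inRange⇒positive (c ∷ l) ps k le

  uniq-concatMap : ∀ {A B : Set} (g : A → List B) {xs} → Unique xs → (∀ {a} → a ∈ xs → Unique (g a)) →
    (∀ {a b} → a ∈ xs → b ∈ xs → a ≢ b → Disjoint (g a) (g b)) → Unique (concatMap g xs)
  uniq-concatMap g []                _ _ = []
  uniq-concatMap g {x ∷ xs} (px ∷ pxs) u d =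
    ++⁺ (u (here refl)) (uniq-concatMap g pxs (u ∘ there) (λ a b → d (there a) (there b))) disjoint
    where
    disjoint : Disjoint (g x) (concatMap g xs)
    disjoint (v∈gx , v∈rest) with find (∈-concatMap⁻ g v∈rest)
    ... | b , b∈xs , v∈gb = d (here refl) (there b∈xs) (All.lookup px b∈xs) (v∈gx , v∈gb)

  uniq-map-on : ∀ {A B : Set} {f : A → B} {xs} → Unique xs →
    (∀ {x y} → x ∈ xs → y ∈ xs → f x ≡ f y → x ≡ y) → Unique (map f xs)
  uniq-map-on []                    _   = []
  uniq-map-on {f = f} {x ∷ xs} (px ∷ pxs) inj =
    AllP.map⁺ (All.tabulate (λ {y} y∈ eq → All.lookup px y∈ (inj (here refl) (there y∈) eq)))
    ∷ uniq-map-on pxs (λ a b → inj (there a) (there b))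

  words-⁻ : ∀ m k π → π ∈ words m k → length π ≡ m × All (InRange k) π
  words-⁻ zero k .[] (here refl) = refl , []
  words-⁻ (suc m) k π mem with find (∈-concatMap⁻ (λ a → map (suc a ∷_) (words m k)) {xs = upTo k} mem)
  ... | a , a∈ , π∈ with ∈-map⁻ (suc a ∷_) π∈
  ... | ρ , ρ∈ , refl with words-⁻ m k ρ ρ∈
  ... | len , all = cong suc len , ((s≤s z≤n , ∈-upTo⁻ a∈) ∷ all)

  words-⁺ : ∀ m k π → length π ≡ m → All (InRange k) π → π ∈ words m k
  words-⁺ zero    k []          refl [] = here refl
  words-⁺ (suc m) k (suc a ∷ ρ) len  ((_ , le) ∷ all) =
    ∈-concatMap⁺ (λ a → map (suc a ∷_) (words m k))
      (lose (∈-upTo⁺ le) (∈-map⁺ (suc a ∷_) (words-⁺ m k ρ (suc-injective len) all)))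

  -- Distinct first letters or distinct tails give distinct words.
  uniq-words : ∀ m k → Unique (words m k)
  uniq-words zero    k = [] ∷ []
  uniq-words (suc m) k = uniq-concatMap (λ a → map (suc a ∷_) (words m k)) (upTo⁺ k)
    (λ _ → map⁺ (λ e → proj₂ (∷-inj e)) (uniq-words m k)) disjoint
    where
    ∷-inj : ∀ {a b : ℕ} {x y : List ℕ} → a ∷ x ≡ b ∷ y → a ≡ b × x ≡ y
    ∷-inj refl = refl , refl
    disjoint : ∀ {a b} → a ∈ upTo k → b ∈ upTo k → a ≢ b →
      Disjoint (map (suc a ∷_) (words m k)) (map (suc b ∷_) (words m k))
    disjoint {a} {b} _ _ ne (p , q) with ∈-map⁻ (suc a ∷_) p | ∈-map⁻ (suc b ∷_) q
    ... | _ , _ , refl | _ , _ , e = ne (suc-injective (proj₁ (∷-inj e)))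

  perms-⁻ : ∀ n π → π ∈ perms n → IsPerm n π
  perms-⁻ n π mem with ∈-filter⁻ unique? {xs = words n n} mem
  ... | w , u with words-⁻ n n π w
  ... | len , all = u , len , all

  perms-⁺ : ∀ n π → IsPerm n π → π ∈ perms n
  perms-⁺ n π (u , len , all) = ∈-filter⁺ unique? (words-⁺ n n π len all) u

  uniq-perms : ∀ n → Unique (perms n)
  uniq-perms n = filter⁺ unique? (uniq-words n n)

  length-insertAt : ∀ j m s → length (insertAt j m s) ≡ suc (length s)
  length-insertAt zero    m s       = refl
  length-insertAt (suc j) m []      = refl
  length-insertAt (suc j) m (a ∷ s) = cong suc (length-insertAt j m s)

  all-insertAt : ∀ {P : ℕ → Set} j m s → P m → All P s → All P (insertAt j m s)
  all-insertAt zero    m s       pm ps        = pm ∷ ps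
  all-insertAt (suc j) m []      pm []        = pm ∷ []
  all-insertAt (suc j) m (a ∷ s) pm (pa ∷ ps) = pa ∷ all-insertAt j m s pm ps

  uniq-insertAt : ∀ j m s → m ∉ s → Unique s → Unique (insertAt j m s)
  uniq-insertAt zero    m s       h u        = AllP.¬Any⇒All¬ s h ∷ u
  uniq-insertAt (suc j) m []      h u        = [] ∷ []
  uniq-insertAt (suc j) m (a ∷ s) h (pa ∷ u) =
    all-insertAt j m s (λ e → h (here (sym e))) pa ∷ uniq-insertAt j m s (h ∘ there) u

  insertAt-injective : ∀ j j' m s s' → m ∉ s → m ∉ s' → j ≤ length s → j' ≤ length s' →
    insertAt j m s ≡ insertAt j' m s' → j ≡ j' × s ≡ s'
  insertAt-injective zero    zero     m s       s'        _ _  _ _ refl = refl , refl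
  insertAt-injective zero    (suc j') m s       (a ∷ s') _ h' _ _ refl = ⊥-elim (h' (here refl))
  insertAt-injective (suc j) zero     m (a ∷ s) s'        h _  _ _ refl = ⊥-elim (h (here refl))
  insertAt-injective (suc j) (suc j') m (a ∷ s) (a' ∷ s') h h' (s≤s l) (s≤s l') e
    with insertAt-injective j j' m s s' (h ∘ there) (h' ∘ there) l l' (∷-injectiveʳ e) | ∷-injectiveˡ e
    where
    open import Data.List.Properties using (∷-injectiveˡ; ∷-injectiveʳ)
  ... | refl , refl | refl = refl , refl

  insertOne : ℕ → List (List ℕ)
  insertOne n = concatMap (λ ρ → map (λ j → insertAt j 1 (map suc ρ)) (upTo (suc n))) (perms n)

  shifted>1 : ∀ {n} ρ → All (InRange n) ρ → All (1 <_) (map suc ρ)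
  shifted>1 ρ all = AllP.map⁺ (All.map (λ { (p , _) → s≤s p }) all)

  perm-length : ∀ n {ρ} → ρ ∈ perms n → length ρ ≡ n
  perm-length n {ρ} mem = proj₁ (proj₂ (perms-⁻ n ρ mem))

  perm-inRange : ∀ n {ρ} → ρ ∈ perms n → All (InRange n) ρ
  perm-inRange n {ρ} mem = proj₂ (proj₂ (perms-⁻ n ρ mem))

  one∉shifted : ∀ {n} ρ → All (InRange n) ρ → 1 ∉ map suc ρ
  one∉shifted ρ all = AllP.All¬⇒¬Any (All.map (λ p → <⇒≢ p) (shifted>1 ρ all))

  uniq-insertOne : ∀ n → Unique (insertOne n)
  uniq-insertOne n = uniq-concatMap insertions (uniq-perms n) uniq-insertions disjoint
    where
    insertions = λ ρ → map (λ j → insertAt j 1 (map suc ρ)) (upTo (suc n))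
    position≤ : ∀ {ρ j} → ρ ∈ perms n → j ∈ upTo (suc n) → j ≤ length (map suc ρ)
    position≤ {ρ} {j} r j∈ =
      subst (j ≤_) (sym (trans (length-map suc ρ) (perm-length n r))) (s≤s⁻¹ (∈-upTo⁻ j∈))
    fresh : ∀ {ρ} → ρ ∈ perms n → 1 ∉ map suc ρ
    fresh {ρ} r = one∉shifted ρ (perm-inRange n r)
    uniq-insertions : ∀ {ρ} → ρ ∈ perms n → Unique (insertions ρ)
    uniq-insertions {ρ} r = uniq-map-on (upTo⁺ (suc n)) (λ {j} {j'} a b e →
      proj₁ (insertAt-injective j j' 1 _ _ (fresh r) (fresh r) (position≤ r a) (position≤ r b) e))
    disjoint : ∀ {ρ ρ'} → ρ ∈ perms n → ρ' ∈ perms n → ρ ≢ ρ' → Disjoint (insertions ρ) (insertions ρ')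
    disjoint {ρ} {ρ'} r r' ne (p , q) with ∈-map⁻ (λ j → insertAt j 1 (map suc ρ)) p | ∈-map⁻ (λ j → insertAt j 1 (map suc ρ')) q
    ... | j , j∈ , refl | j' , j'∈ , e =
      ne (map-injective suc-injective
           (proj₂ (insertAt-injective j j' 1 _ _ (fresh r) (fresh r') (position≤ r j∈) (position≤ r' j'∈) e)))

  insertOne-⁻ : ∀ n π → π ∈ insertOne n → IsPerm (suc n) π
  insertOne-⁻ n π mem with find (∈-concatMap⁻ (λ ρ → map (λ j → insertAt j 1 (map suc ρ)) (upTo (suc n))) {xs = perms n} mem)
  ... | ρ , ρ∈ , π∈ with ∈-map⁻ (λ j → insertAt j 1 (map suc ρ)) {xs = upTo (suc n)} π∈
  ... | j , j∈ , refl with perms-⁻ n ρ ρ∈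
  ... | u , len , all =
    uniq-insertAt j 1 (map suc ρ) (one∉shifted ρ all) (map⁺ suc-injective u) ,
    trans (length-insertAt j 1 (map suc ρ)) (cong suc (trans (length-map suc ρ) len)) ,
    all-insertAt j 1 (map suc ρ) (s≤s z≤n , s≤s z≤n) (AllP.map⁺ (All.map (λ { (_ , an) → s≤s z≤n , s≤s an }) all))

  all-delete : ∀ {P : ℕ → Set} (xs : List ℕ) {y : ℕ} {ys : List ℕ} → All P (xs ++ y ∷ ys) → All P (xs ++ ys)
  all-delete []       (_ ∷ a) = a
  all-delete (x ∷ xs) (p ∷ a) = p ∷ all-delete xs a

  uniq-delete : ∀ (xs : List ℕ) {y : ℕ} {ys : List ℕ} → Unique (xs ++ y ∷ ys) → Unique (xs ++ ys)
  uniq-delete []       (_ ∷ u)  = u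
  uniq-delete (x ∷ xs) (px ∷ u) = all-delete xs px ∷ uniq-delete xs u

  deleted∉ : ∀ (xs : List ℕ) {y : ℕ} {ys : List ℕ} → Unique (xs ++ y ∷ ys) → y ∉ xs ++ ys
  deleted∉ []       (py ∷ _) = AllP.All¬⇒¬Any py
  deleted∉ (x ∷ xs) {y} {ys} (px ∷ u) (here e) = All.lookup px (∈-insert xs {ys}) (sym e)
  deleted∉ (x ∷ xs) (px ∷ u) (there i) = deleted∉ xs u i

  range-shrink : ∀ {k} l → All (InRange (suc k)) l → suc k ∉ l → All (InRange k) l
  range-shrink l all k∉ = All.zipWith (λ { ((p , q) , ne) → p , s≤s⁻¹ (≤∧≢⇒< q (ne ∘ sym)) })
                                      (all , AllP.¬Any⇒All¬ l k∉)

  length-bound : ∀ k (l : List ℕ) → Unique l → All (InRange k) l → length l ≤ k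
  length-bound zero    []      _ _              = z≤n
  length-bound zero    (a ∷ l) _ ((p , q) ∷ _) = ⊥-elim (<⇒≱ p q)
  length-bound (suc k) l u all with suc k ∈? l
  ... | no k∉ = m≤n⇒m≤1+n (length-bound k l u (range-shrink l all k∉))
  ... | yes k∈ with ∈-∃++ k∈
  ... | xs , ys , refl =
    subst (_≤ suc k) (sym (length-++-sucʳ xs (suc k) ys))
      (s≤s (length-bound k (xs ++ ys) (uniq-delete xs u) (range-shrink (xs ++ ys) (all-delete xs all) (deleted∉ xs u))))


  Above1 : ℕ → ℕ → Set
  Above1 k a = 2 ≤ a × a ≤ suc k

  above1 : ∀ {k} l → All (InRange (suc k)) l → 1 ∉ l → All (Above1 k) l
  above1 l all 1∉ = All.zipWith (λ { ((p , q) , ne) → ≤∧≢⇒< p ne , q }) (all , AllP.¬Any⇒All¬ l 1∉)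

  pred-inRange : ∀ {k} l → All (Above1 k) l → All (InRange k) (map pred l)
  pred-inRange l all = AllP.map⁺ (All.map (λ { (s≤s (s≤s _) , s≤s q) → s≤s z≤n , q }) all)

  uniq-pred : ∀ {k} l → Unique l → All (Above1 k) l → Unique (map pred l)
  uniq-pred l u all = uniq-map-on u (λ a b → pred-injective-above1 (All.lookup all a) (All.lookup all b))
    where
    pred-injective-above1 : ∀ {k a c} → Above1 k a → Above1 k c → pred a ≡ pred c → a ≡ c
    pred-injective-above1 (s≤s _ , _) (s≤s _ , _) = pred-injective

  map-suc-pred : ∀ {k} l → All (Above1 k) l → map suc (map pred l) ≡ l
  map-suc-pred []          []        = refl
  map-suc-pred (suc a ∷ l) (_ ∷ all) = cong (suc a ∷_) (map-suc-pred l all)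

  -- Every permutation of [n+1] contains the letter 1 (by pigeonhole).
  one∈ : ∀ n π → IsPerm (suc n) π → 1 ∈ π
  one∈ n π (u , len , all) with 1 ∈? π
  ... | yes p  = p
  ... | no 1∉ = ⊥-elim (<⇒≱ (≤-reflexive (sym (trans (length-map pred π) len)))
                            (length-bound n (map pred π) (uniq-pred π u shifted) (pred-inRange π shifted)))
    where
    shifted = above1 π all 1∉

  insertAt-length : ∀ (xs ys : List ℕ) m → insertAt (length xs) m (xs ++ ys) ≡ xs ++ m ∷ ys
  insertAt-length []       ys m = refl
  insertAt-length (x ∷ xs) ys m = cong (x ∷_) (insertAt-length xs ys m)

  -- Every permutation xs 1 ys of [n+1] is the insertion of 1 at position
  -- length xs into 1 + (xs ys - 1).
  insertOne-⁺ : ∀ n π → IsPerm (suc n) π → π ∈ insertOne n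
  insertOne-⁺ n π perm@(u , len , all) with ∈-∃++ (one∈ n π perm)
  ... | xs , ys , refl = subst (_∈ insertOne n) reassemble member
    where
    rest = xs ++ ys
    rest>1 : All (Above1 n) rest
    rest>1 = above1 rest (all-delete xs all) (deleted∉ xs u)
    ρ = map pred rest
    len-rest : length rest ≡ n
    len-rest = suc-injective (trans (sym (length-++-sucʳ xs 1 ys)) len)
    ρ-perm : IsPerm n ρ
    ρ-perm = uniq-pred rest (uniq-delete xs u) rest>1 , trans (length-map pred rest) len-rest , pred-inRange rest rest>1
    position< : length xs < suc n
    position< = s≤s (subst (length xs ≤_) len-rest
                      (subst (length xs ≤_) (sym (length-++ xs)) (m≤m+n (length xs) (length ys))))
    member : insertAt (length xs) 1 (map suc ρ) ∈ insertOne n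
    member = ∈-concatMap⁺ (λ ρ → map (λ j → insertAt j 1 (map suc ρ)) (upTo (suc n)))
               (lose (perms-⁺ n ρ ρ-perm) (∈-map⁺ (λ j → insertAt j 1 (map suc ρ)) (∈-upTo⁺ position<)))
    reassemble : insertAt (length xs) 1 (map suc ρ) ≡ xs ++ 1 ∷ ys
    reassemble = trans (cong (insertAt (length xs) 1) (map-suc-pred rest rest>1)) (insertAt-length xs ys 1)

  -- Both lists are duplicate-free with the same members.
  perms-suc↭insertOne : ∀ n → perms (suc n) ↭ insertOne n
  perms-suc↭insertOne n = ∼bag⇒↭ (unique∧set⇒bag (uniq-perms (suc n)) (uniq-insertOne n)
    (mk⇔ (λ m → insertOne-⁺ n _ (perms-⁻ (suc n) _ m)) (λ m → perms-⁺ (suc n) _ (insertOne-⁻ n _ m))))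

module Sums {c ℓ} (R : CommutativeSemiring c ℓ) where

  open import Data.Nat as ℕ using (ℕ; zero; suc; _<_; z≤n; s≤s)
  open import Data.Nat.Properties using (m∸[m∸n]≡n)
  open import Data.Nat.Combinatorics using (_C_; nCk≡nC[n∸k]; nCk+nC[k+1]≡[n+1]C[k+1])
  open import Data.List using (List; []; _∷_; _++_; map; upTo; applyUpTo; concatMap)
  open import Data.List.Membership.Propositional using (_∈_)
  open import Data.List.Relation.Unary.Any using (here; there)
  open import Data.List.Relation.Binary.Permutation.Propositional as Perm using (_↭_)
  import Relation.Binary.PropositionalEquality as ≡
  open ≡ using (_≡_)
  open import Function using (_∘_)
  open CommutativeSemiring R
  open import Algebra.Properties.CommutativeSemigroup +-commutativeSemigroup using (interchange)
  open import Relation.Binary.Reasoning.Setoid setoid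
  open Poly R

  Σl-cong∈ : ∀ {A : Set} {f g : A → Carrier} xs → (∀ {x} → x ∈ xs → f x ≈ g x) → Σl f xs ≈ Σl g xs
  Σl-cong∈ []       h = refl
  Σl-cong∈ (x ∷ xs) h = +-cong (h (here ≡.refl)) (Σl-cong∈ xs (h ∘ there))

  Σl-↭ : ∀ {A : Set} (f : A → Carrier) {xs ys} → xs ↭ ys → Σl f xs ≈ Σl f ys
  Σl-↭ f Perm.refl          = refl
  Σl-↭ f (Perm.prep x p)    = +-congˡ (Σl-↭ f p)
  Σl-↭ f (Perm.swap x y p)  =
    trans (sym (+-assoc _ _ _)) (trans (+-cong (+-comm _ _) (Σl-↭ f p)) (+-assoc _ _ _))
  Σl-↭ f (Perm.trans p q)   = trans (Σl-↭ f p) (Σl-↭ f q)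

  Σl-++ : ∀ {A : Set} (f : A → Carrier) xs ys → Σl f (xs ++ ys) ≈ Σl f xs + Σl f ys
  Σl-++ f []       ys = sym (+-identityˡ _)
  Σl-++ f (x ∷ xs) ys = trans (+-congˡ (Σl-++ f xs ys)) (sym (+-assoc _ _ _))

  Σl-concatMap : ∀ {A B : Set} (f : B → Carrier) (g : A → List B) xs →
    Σl f (concatMap g xs) ≈ Σl (λ a → Σl f (g a)) xs
  Σl-concatMap f g []       = refl
  Σl-concatMap f g (x ∷ xs) = trans (Σl-++ f (g x) (concatMap g xs)) (+-congˡ (Σl-concatMap f g xs))

  Σl-map : ∀ {A B : Set} (f : B → Carrier) (g : A → B) xs → Σl f (map g xs) ≡ Σl (f ∘ g) xs
  Σl-map f g []       = ≡.refl
  Σl-map f g (x ∷ xs) = ≡.cong (f (g x) +_) (Σl-map f g xs)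

  Σl-+ : ∀ {A : Set} (f g : A → Carrier) xs → Σl (λ a → f a + g a) xs ≈ Σl f xs + Σl g xs
  Σl-+ f g []       = sym (+-identityˡ _)
  Σl-+ f g (x ∷ xs) = trans (+-congˡ (Σl-+ f g xs)) (interchange _ _ _ _)

  Σl-*ˡ : ∀ {A : Set} (k : Carrier) (f : A → Carrier) xs → Σl (λ a → k * f a) xs ≈ k * Σl f xs
  Σl-*ˡ k f []       = sym (zeroʳ k)
  Σl-*ˡ k f (x ∷ xs) = trans (+-congˡ (Σl-*ˡ k f xs)) (sym (distribˡ _ _ _))

  Σl-0 : ∀ {A : Set} (xs : List A) → Σl (λ _ → 0#) xs ≈ 0#
  Σl-0 []       = refl
  Σl-0 (x ∷ xs) = trans (+-identityˡ _) (Σl-0 xs)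

  Σr : ℕ → (ℕ → Carrier) → Carrier
  Σr zero    f = 0#
  Σr (suc n) f = f 0 + Σr n (λ i → f (suc i))

  Σl-upTo : ∀ (f : ℕ → Carrier) n → Σl f (upTo n) ≡ Σr n f
  Σl-upTo f n = applyUpTo-sum f (λ i → i) n
    where
    applyUpTo-sum : ∀ (f : ℕ → Carrier) g n → Σl f (applyUpTo g n) ≡ Σr n (f ∘ g)
    applyUpTo-sum f g zero    = ≡.refl
    applyUpTo-sum f g (suc n) = ≡.cong (f (g 0) +_) (applyUpTo-sum f (g ∘ suc) n)

  Σr-cong : ∀ n {f g : ℕ → Carrier} → (∀ i → i < n → f i ≈ g i) → Σr n f ≈ Σr n g
  Σr-cong zero    h = refl
  Σr-cong (suc n) h = +-cong (h 0 (s≤s z≤n)) (Σr-cong n (λ i lt → h (suc i) (s≤s lt)))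

  Σr-split : ∀ k m (f : ℕ → Carrier) → Σr (k ℕ.+ m) f ≈ Σr k f + Σr m (λ i → f (k ℕ.+ i))
  Σr-split zero    m f = sym (+-identityˡ _)
  Σr-split (suc k) m f = trans (+-congˡ (Σr-split k m (f ∘ suc))) (sym (+-assoc _ _ _))

  Σr-*ʳ : ∀ n (f : ℕ → Carrier) k → Σr n (λ i → f i * k) ≈ Σr n f * k
  Σr-*ʳ zero    f k = sym (zeroˡ k)
  Σr-*ʳ (suc n) f k = trans (+-congˡ (Σr-*ʳ n (f ∘ suc) k)) (sym (distribʳ _ _ _))

  Σr-*ˡ : ∀ n (f : ℕ → Carrier) k → Σr n (λ i → k * f i) ≈ k * Σr n f
  Σr-*ˡ zero    f k = sym (zeroʳ k)
  Σr-*ˡ (suc n) f k = trans (+-congˡ (Σr-*ˡ n (f ∘ suc) k)) (sym (distribˡ _ _ _))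

  Σl-Σr : ∀ {A : Set} n (h : A → ℕ → Carrier) xs →
    Σl (λ a → Σr n (h a)) xs ≈ Σr n (λ i → Σl (λ a → h a i) xs)
  Σl-Σr zero    h xs = Σl-0 xs
  Σl-Σr (suc n) h xs =
    trans (Σl-+ (λ a → h a 0) (λ a → Σr n (λ i → h a (suc i))) xs) (+-congˡ (Σl-Σr n (λ a i → h a (suc i)) xs))

  Σ<-reverse : ∀ n (g : ℕ → Carrier) → Σ< n g ≈ Σr n (λ j → g (n ℕ.∸ suc j))
  Σ<-reverse zero    g = refl
  Σ<-reverse (suc n) g = trans (+-congʳ (Σ<-reverse n g)) (+-comm _ _)

  nat-+ : ∀ a b → nat (a ℕ.+ b) ≈ nat a + nat b
  nat-+ zero    b = sym (+-identityˡ _)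
  nat-+ (suc a) b = trans (+-congˡ (nat-+ a b)) (sym (+-assoc _ _ _))

  nat-pascal : ∀ n k X → nat (n C k) * X + nat (n C suc k) * X ≈ nat (suc n C suc k) * X
  nat-pascal n k X = begin
    nat (n C k) * X + nat (n C suc k) * X ≈⟨ sym (distribʳ _ _ _) ⟩
    (nat (n C k) + nat (n C suc k)) * X   ≈⟨ *-congʳ (sym (nat-+ (n C k) (n C suc k))) ⟩
    nat (n C k ℕ.+ n C suc k) * X         ≡⟨ ≡.cong (λ t → nat t * X) (nCk+nC[k+1]≡[n+1]C[k+1] n k) ⟩
    nat (suc n C suc k) * X ∎

  Σ<-binomial-reverse : ∀ n (f g : ℕ → Carrier) →
    Σ< n (λ k → nat (n C k) * f k * g (n ℕ.∸ k))
      ≈ Σr n (λ i → nat (n C suc i) * (g (suc i) * f (n ℕ.∸ suc i)))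
  Σ<-binomial-reverse n f g =
    trans (Σ<-reverse n (λ k → nat (n C k) * f k * g (n ℕ.∸ k))) (Σr-cong n reflected)
    where
    reflected : ∀ i → i < n →
      nat (n C (n ℕ.∸ suc i)) * f (n ℕ.∸ suc i) * g (n ℕ.∸ (n ℕ.∸ suc i))
        ≈ nat (n C suc i) * (g (suc i) * f (n ℕ.∸ suc i))
    reflected i i<n = begin
      nat (n C (n ℕ.∸ suc i)) * f (n ℕ.∸ suc i) * g (n ℕ.∸ (n ℕ.∸ suc i))
        ≡⟨ ≡.cong₂ (λ a b → nat a * f (n ℕ.∸ suc i) * g b) (≡.sym (nCk≡nC[n∸k] i<n)) (m∸[m∸n]≡n i<n) ⟩
      nat (n C suc i) * f (n ℕ.∸ suc i) * g (suc i)   ≈⟨ *-assoc _ _ _ ⟩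
      nat (n C suc i) * (f (n ℕ.∸ suc i) * g (suc i)) ≈⟨ *-congˡ (*-comm _ _) ⟩
      nat (n C suc i) * (g (suc i) * f (n ℕ.∸ suc i)) ∎

module DescentSums {c ℓ} (R : CommutativeSemiring c ℓ) where

  open import Data.Nat as ℕ using (ℕ; zero; suc; _∸_; _≤_; _<_; s≤s; s≤s⁻¹)
  import Data.Nat.Properties as ℕP
  open import Data.Nat.Combinatorics using (_C_; k>n⇒nCk≡0)
  open import Data.Bool using (Bool)
  open import Data.List using (List; []; map; take; drop; length; upTo)
  open import Data.List.Properties using (length-map; take-map; drop-map; length-take; length-drop)
  open import Data.List.Membership.Propositional using (_∈_)
  open import Data.List.Relation.Unary.All using (All)
  import Data.List.Relation.Unary.All.Properties as AllP
  import Relation.Binary.PropositionalEquality as ≡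
  open ≡ using (_≡_)
  open import Data.Sum using (inj₁; inj₂)
  open import Function using (_∘_)
  open CommutativeSemiring R
  open Poly R
  open Sums R
  open DescentWords
  open Permutations
  open import Relation.Binary.Reasoning.Setoid setoid

  descents-insertOne : ∀ {m} j σ → All (InRange m) σ → j ≤ length σ →
    descents (insertAt j 1 (map suc σ)) ≡ insertBit j (descents σ)
  descents-insertOne j σ all j≤ =
    ≡.trans (descents-insertMin j (map suc σ) (shifted>1 σ all) (≡.subst (j ≤_) (≡.sym (length-map suc σ)) j≤))
            (≡.cong (insertBit j) (descents-map-suc σ))

  descents-take-shifted : ∀ t ρ → descents (take t (map suc ρ)) ≡ descents (take t ρ)
  descents-take-shifted t ρ = ≡.trans (≡.cong descents (take-map t ρ)) (descents-map-suc (take t ρ))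

  descents-drop-shifted : ∀ t ρ → descents (drop t (map suc ρ)) ≡ descents (drop t ρ)
  descents-drop-shifted t ρ = ≡.trans (≡.cong descents (drop-map t ρ)) (descents-map-suc (drop t ρ))

  Σ-perms-suc : ∀ n (h : List ℕ → Carrier) →
    Σl h (perms (suc n)) ≈ Σl (λ ρ → Σr (suc n) (λ j → h (insertAt j 1 (map suc ρ)))) (perms n)
  Σ-perms-suc n h = begin
    Σl h (perms (suc n))                     ≈⟨ Σl-↭ h (perms-suc↭insertOne n) ⟩
    Σl h (insertOne n)                       ≈⟨ Σl-concatMap h insertions (perms n) ⟩
    Σl (λ ρ → Σl h (insertions ρ)) (perms n) ≈⟨ Σl-cong∈ (perms n) (λ {ρ} _ → reflexive (positions ρ)) ⟩
    Σl (λ ρ → Σr (suc n) (λ j → h (insertAt j 1 (map suc ρ)))) (perms n) ∎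
    where
    insertions : List ℕ → List (List ℕ)
    insertions ρ = map (λ j → insertAt j 1 (map suc ρ)) (upTo (suc n))
    positions : ∀ ρ → Σl h (insertions ρ) ≡ Σr (suc n) (λ j → h (insertAt j 1 (map suc ρ)))
    positions ρ = ≡.trans (Σl-map h (λ j → insertAt j 1 (map suc ρ)) (upTo (suc n)))
                          (Σl-upTo (λ j → h (insertAt j 1 (map suc ρ))) (suc n))

  descentSum : ℕ → (List Bool → Carrier) → Carrier
  descentSum m F = Σl (F ∘ descents) (perms m)

  insertBitSum : (List Bool → Carrier) → List Bool → Carrier
  insertBitSum F u = Σr (suc (length u)) (λ j → F (insertBit j u))

  descentSum-suc : ∀ m F → descentSum (suc m) F ≈ descentSum m (insertBitSum F)
  descentSum-suc m F = trans (Σ-perms-suc m (F ∘ descents)) (Σl-cong∈ (perms m) positions)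
    where
    positions : ∀ {ρ} → ρ ∈ perms m →
      Σr (suc m) (λ j → F (descents (insertAt j 1 (map suc ρ)))) ≈ insertBitSum F (descents ρ)
    positions {ρ} mem = trans
      (Σr-cong (suc m) (λ j lt → reflexive (≡.cong F
         (descents-insertOne j ρ (perm-inRange m mem) (≡.subst (j ≤_) (≡.sym (perm-length m mem)) (s≤s⁻¹ lt))))))
      (reflexive (≡.cong (λ k → Σr (suc k) (λ j → F (insertBit j (descents ρ))))
                         (≡.sym (≡.trans (length-descents ρ) (perm-length m mem)))))

  splitWeight : ℕ → (List Bool → Carrier) → (List Bool → Carrier) → List ℕ → Carrier
  splitWeight k F G π = F (descents (take k π)) * G (descents (drop k π))

  insert-before-cut : ∀ n {ρ} → ρ ∈ perms n → ∀ k → k ≤ n → ∀ F G →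
    Σr (suc k) (λ j → splitWeight (suc k) F G (insertAt j 1 (map suc ρ)))
      ≈ insertBitSum F (descents (take k ρ)) * G (descents (drop k ρ))
  insert-before-cut n {ρ} mem k k≤n F G = begin
    Σr (suc k) (λ j → splitWeight (suc k) F G (insertAt j 1 (map suc ρ)))
      ≈⟨ Σr-cong (suc k) (λ j lt → reflexive (≡.cong₂ _*_ (≡.cong F (prefix j (s≤s⁻¹ lt))) (≡.cong G (suffix j (s≤s⁻¹ lt))))) ⟩
    Σr (suc k) (λ j → F (insertBit j U) * G V)
      ≈⟨ Σr-*ʳ (suc k) (λ j → F (insertBit j U)) (G V) ⟩
    Σr (suc k) (λ j → F (insertBit j U)) * G V
      ≡⟨ ≡.cong (λ t → Σr (suc t) (λ j → F (insertBit j U)) * G V) (≡.sym (≡.trans (length-descents (take k ρ)) length-prefix)) ⟩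
    insertBitSum F U * G V ∎
    where
    U = descents (take k ρ)
    V = descents (drop k ρ)
    length-prefix : length (take k ρ) ≡ k
    length-prefix = ≡.trans (length-take k ρ) (ℕP.m≤n⇒m⊓n≡m (≡.subst (k ≤_) (≡.sym (perm-length n mem)) k≤n))
    prefix : ∀ j → j ≤ k → descents (take (suc k) (insertAt j 1 (map suc ρ))) ≡ insertBit j U
    prefix j j≤k = ≡.trans (≡.cong descents (≡.trans (take-insertAt-≤ j k 1 (map suc ρ) j≤k)
                                                     (≡.cong (insertAt j 1) (take-map k ρ))))
                           (descents-insertOne j (take k ρ) (AllP.take⁺ k (perm-inRange n mem))
                                               (≡.subst (j ≤_) (≡.sym length-prefix) j≤k))
    suffix : ∀ j → j ≤ k → descents (drop (suc k) (insertAt j 1 (map suc ρ))) ≡ V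
    suffix j j≤k = ≡.trans (≡.cong descents (drop-insertAt-≤ j k 1 (map suc ρ) j≤k)) (descents-drop-shifted k ρ)

  insert-after-cut : ∀ n {ρ} → ρ ∈ perms n → ∀ k F G →
    Σr (n ∸ k) (λ i → splitWeight (suc k) F G (insertAt (suc k ℕ.+ i) 1 (map suc ρ)))
      ≈ F (descents (take (suc k) ρ)) * Σr (n ∸ k) (λ i → G (insertBit i (descents (drop (suc k) ρ))))
  insert-after-cut n {ρ} mem k F G =
    trans (Σr-cong (n ∸ k) (λ i lt → reflexive (≡.cong₂ _*_ (≡.cong F (prefix i lt)) (≡.cong G (suffix i lt)))))
          (Σr-*ˡ (n ∸ k) (λ i → G (insertBit i (descents (drop (suc k) ρ)))) _)
    where
    k<n : ∀ {i} → i < n ∸ k → k < n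
    k<n {i} lt = ℕP.m∸n≢0⇒n<m (λ e → ℕP.n≮0 (≡.subst (i <_) e lt))
    cut≤ : ∀ {i} → i < n ∸ k → suc k ≤ length (map suc ρ)
    cut≤ lt = ≡.subst (suc k ≤_) (≡.sym (≡.trans (length-map suc ρ) (perm-length n mem))) (k<n lt)
    i≤ : ∀ {i} → i < n ∸ k → i ≤ length (drop (suc k) ρ)
    i≤ {i} lt = ≡.subst (i ≤_) (≡.sym (≡.trans (length-drop (suc k) ρ) (≡.cong (_∸ suc k) (perm-length n mem))))
                        (s≤s⁻¹ (≡.subst (i <_) (ℕP.+-∸-assoc 1 (k<n lt)) lt))
    prefix : ∀ i → i < n ∸ k → descents (take (suc k) (insertAt (suc k ℕ.+ i) 1 (map suc ρ))) ≡ descents (take (suc k) ρ)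
    prefix i lt = ≡.trans (≡.cong descents (take-insertAt-≥ (suc k) i 1 (map suc ρ) (cut≤ lt)))
                          (descents-take-shifted (suc k) ρ)
    suffix : ∀ i → i < n ∸ k →
      descents (drop (suc k) (insertAt (suc k ℕ.+ i) 1 (map suc ρ))) ≡ insertBit i (descents (drop (suc k) ρ))
    suffix i lt = ≡.trans (≡.cong descents (≡.trans (drop-insertAt-≥ (suc k) i 1 (map suc ρ) (cut≤ lt))
                                                     (≡.cong (insertAt i 1) (drop-map (suc k) ρ))))
                          (descents-insertOne i (drop (suc k) ρ) (AllP.drop⁺ (suc k) (perm-inRange n mem)) (i≤ lt))

  insert-around-cut : ∀ n {ρ} → ρ ∈ perms n → ∀ k → k ≤ n → ∀ F G →
    Σr (suc n) (λ j → splitWeight (suc k) F G (insertAt j 1 (map suc ρ)))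
      ≈ insertBitSum F (descents (take k ρ)) * G (descents (drop k ρ))
        + F (descents (take (suc k) ρ)) * Σr (n ∸ k) (λ i → G (insertBit i (descents (drop (suc k) ρ))))
  insert-around-cut n {ρ} mem k k≤n F G = begin
    Σr (suc n) h                                      ≡⟨ ≡.cong (λ t → Σr t h) (≡.sym (ℕP.m+[n∸m]≡n (s≤s k≤n))) ⟩
    Σr (suc k ℕ.+ (n ∸ k)) h                          ≈⟨ Σr-split (suc k) (n ∸ k) h ⟩
    Σr (suc k) h + Σr (n ∸ k) (λ i → h (suc k ℕ.+ i)) ≈⟨ +-cong (insert-before-cut n mem k k≤n F G) (insert-after-cut n mem k F G) ⟩
    insertBitSum F (descents (take k ρ)) * G (descents (drop k ρ))
      + F (descents (take (suc k) ρ)) * Σr (n ∸ k) (λ i → G (insertBit i (descents (drop (suc k) ρ)))) ∎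
    where
    h : ℕ → Carrier
    h j = splitWeight (suc k) F G (insertAt j 1 (map suc ρ))

  suffix-insertions : ∀ n {ρ} → ρ ∈ perms n → ∀ k → k < n → ∀ F G →
    F (descents (take (suc k) ρ)) * Σr (n ∸ k) (λ i → G (insertBit i (descents (drop (suc k) ρ))))
      ≈ splitWeight (suc k) F (insertBitSum G) ρ
  suffix-insertions n {ρ} mem k k<n F G =
    *-congˡ (reflexive (≡.cong (λ t → Σr t (λ i → G (insertBit i (descents (drop (suc k) ρ))))) (≡.sym length-suffix)))
    where
    length-suffix : suc (length (descents (drop (suc k) ρ))) ≡ n ∸ k
    length-suffix = ≡.trans (≡.cong suc (≡.trans (length-descents (drop (suc k) ρ))
                                                  (≡.trans (length-drop (suc k) ρ) (≡.cong (_∸ suc k) (perm-length n mem)))))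
                            (≡.sym (ℕP.+-∸-assoc 1 k<n))

  no-suffix-insertions : ∀ n ρ (F G : List Bool → Carrier) →
    F (descents (take (suc n) ρ)) * Σr (n ∸ n) (λ i → G (insertBit i (descents (drop (suc n) ρ)))) ≈ 0#
  no-suffix-insertions n ρ F G =
    trans (*-congˡ (reflexive (≡.cong (λ t → Σr t (λ i → G (insertBit i (descents (drop (suc n) ρ))))) (ℕP.n∸n≡0 n))))
          (zeroʳ _)

  shuffle-empty-prefix : ∀ n (F G : List Bool → Carrier) →
    Σl (splitWeight 0 F G) (perms n) ≈ nat (n C 0) * (descentSum 0 F * descentSum n G)
  shuffle-empty-prefix n F G = begin
    Σl (λ π → F [] * G (descents π)) (perms n)      ≈⟨ Σl-*ˡ (F []) (G ∘ descents) (perms n) ⟩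
    F [] * descentSum n G                           ≈⟨ *-congʳ (sym (+-identityʳ _)) ⟩
    descentSum 0 F * descentSum n G                 ≈⟨ sym (*-identityˡ _) ⟩
    1# * (descentSum 0 F * descentSum n G)          ≈⟨ *-congʳ (sym (+-identityʳ _)) ⟩
    nat (n C 0) * (descentSum 0 F * descentSum n G) ∎

  -- Shuffle lemma: a permutation of [n] is a choice of the k letters in front
  -- together with the patterns of both parts, so
  --   Σ_{π ∈ perms n} F(d(π₁⋯π_k))·G(d(π_{k+1}⋯πₙ)) = C(n,k)·(Σ_{perms k} F)·(Σ_{perms (n-k)} G).
  -- Proved by induction on n, locating the letter 1 before or after the cut.
  shuffle : ∀ n k → k ≤ n → ∀ (F G : List Bool → Carrier) →
    Σl (splitWeight k F G) (perms n) ≈ nat (n C k) * (descentSum k F * descentSum (n ∸ k) G)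
  shuffle n zero _ F G = shuffle-empty-prefix n F G
  shuffle (suc n) (suc k) (s≤s k≤n) F G = begin
    Σl (splitWeight (suc k) F G) (perms (suc n))
      ≈⟨ Σ-perms-suc n (splitWeight (suc k) F G) ⟩
    Σl (λ ρ → Σr (suc n) (λ j → splitWeight (suc k) F G (insertAt j 1 (map suc ρ)))) (perms n)
      ≈⟨ Σl-cong∈ (perms n) (λ mem → insert-around-cut n mem k k≤n F G) ⟩
    Σl (λ ρ → before ρ + after ρ) (perms n)
      ≈⟨ Σl-+ before after (perms n) ⟩
    Σl before (perms n) + Σl after (perms n)
      ≈⟨ +-cong before-sum after-sum ⟩
    nat (n C k) * X + nat (n C suc k) * X
      ≈⟨ nat-pascal n k X ⟩
    nat (suc n C suc k) * X ∎
    where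
    X = descentSum (suc k) F * descentSum (n ∸ k) G
    before after : List ℕ → Carrier
    before ρ = insertBitSum F (descents (take k ρ)) * G (descents (drop k ρ))
    after  ρ = F (descents (take (suc k) ρ)) * Σr (n ∸ k) (λ i → G (insertBit i (descents (drop (suc k) ρ))))
    -- 1 within the first k+1 positions: the case (n, k) with insertBitSum F for F
    before-sum : Σl before (perms n) ≈ nat (n C k) * X
    before-sum = trans (shuffle n k k≤n (insertBitSum F) G) (*-congˡ (*-congʳ (sym (descentSum-suc k F))))
    -- 1 after the first k+1 letters: the case (n, k+1) with insertBitSum G for G
    after-sum : Σl after (perms n) ≈ nat (n C suc k) * X
    after-sum with ℕP.m≤n⇒m<n∨m≡n k≤n
    ... | inj₁ k<n = begin
      Σl after (perms n)                                     ≈⟨ Σl-cong∈ (perms n) (λ mem → suffix-insertions n mem k k<n F G) ⟩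
      Σl (splitWeight (suc k) F (insertBitSum G)) (perms n) ≈⟨ shuffle n (suc k) k<n F (insertBitSum G) ⟩
      nat (n C suc k) * (descentSum (suc k) F * descentSum (n ∸ suc k) (insertBitSum G))
        ≈⟨ *-congˡ (*-congˡ (sym (descentSum-suc (n ∸ suc k) G))) ⟩
      nat (n C suc k) * (descentSum (suc k) F * descentSum (suc (n ∸ suc k)) G)
        ≡⟨ ≡.cong (λ t → nat (n C suc k) * (descentSum (suc k) F * descentSum t G)) (≡.sym (ℕP.+-∸-assoc 1 k<n)) ⟩
      nat (n C suc k) * X ∎
    ... | inj₂ ≡.refl = begin
      Σl after (perms n)      ≈⟨ trans (Σl-cong∈ (perms n) (λ {ρ} _ → no-suffix-insertions n ρ F G)) (Σl-0 (perms n)) ⟩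
      0#                      ≈⟨ sym (zeroˡ X) ⟩
      nat 0 * X               ≡⟨ ≡.cong (λ t → nat t * X) (≡.sym (k>n⇒nCk≡0 (ℕP.n<1+n n))) ⟩
      nat (n C suc n) * X ∎

module Weights {c ℓ} (R : CommutativeSemiring c ℓ) (x y z w : CommutativeSemiring.Carrier R) where

  open import Data.Nat as ℕ using (ℕ; suc; _∸_; _<_; z≤n)
  import Data.Nat.Properties as ℕP
  open import Data.Bool using (Bool; true; false)
  open import Data.List using (List; []; _∷_; _++_; map; take; drop; length)
  open import Data.List.Membership.Propositional using (_∈_)
  open import Data.List.Relation.Unary.All using (All; _∷_)
  import Data.List.Relation.Unary.All.Properties as AllP
  import Relation.Binary.PropositionalEquality as ≡
  open ≡ using (_≡_)
  open import Data.Product using (_,_)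
  open import Function using (_∘_)
  open import Data.Empty using (⊥-elim)
  import Algebra.Definitions.RawSemiring as RS
  open CommutativeSemiring R
  open RS rawSemiring using (_^_)
  open import Algebra.Properties.Semiring.Exp semiring using (^-homo-*)
  open import Algebra.Properties.CommutativeSemigroup *-commutativeSemigroup using (interchange; x∙yz≈y∙xz)
  open import Relation.Binary.Reasoning.Setoid setoid
  open Poly R
  open Sums R
  open DescentWords
  open Statistics
  open Permutations
  open DescentSums R

  monomial : ℕ → ℕ → ℕ → ℕ → Carrier
  monomial a b c d = x ^ a * y ^ b * z ^ c * w ^ d

  monomial-+ : ∀ a b c d a' b' c' d' →
    monomial (a ℕ.+ a') (b ℕ.+ b') (c ℕ.+ c') (d ℕ.+ d') ≈ monomial a b c d * monomial a' b' c' d'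
  monomial-+ a b c d a' b' c' d' = begin
    monomial (a ℕ.+ a') (b ℕ.+ b') (c ℕ.+ c') (d ℕ.+ d')
      ≈⟨ *-cong (*-cong (*-cong (^-homo-* x a a') (^-homo-* y b b')) (^-homo-* z c c')) (^-homo-* w d d') ⟩
    (x ^ a * x ^ a') * (y ^ b * y ^ b') * (z ^ c * z ^ c') * (w ^ d * w ^ d')
      ≈⟨ *-congʳ (*-congʳ (interchange _ _ _ _)) ⟩
    (x ^ a * y ^ b) * (x ^ a' * y ^ b') * (z ^ c * z ^ c') * (w ^ d * w ^ d')
      ≈⟨ *-congʳ (interchange _ _ _ _) ⟩
    (x ^ a * y ^ b * z ^ c) * (x ^ a' * y ^ b' * z ^ c') * (w ^ d * w ^ d')
      ≈⟨ interchange _ _ _ _ ⟩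
    monomial a b c d * monomial a' b' c' d' ∎

  weightP : List Bool → Carrier
  weightP u = monomial (peaks u) (doubleDescents u) (peaks u ℕ.+ 1) (doubleAscents u)

  weightQ : List Bool → Carrier
  weightQ u = monomial (peaks v) (doubleDescents v) (peaks v) (doubleAscents v)
    where v = markLast u

  lastBit-descents-false : ∀ π → lastBit false (descents π) ≡ false
  lastBit-descents-false []      = ≡.refl
  lastBit-descents-false (a ∷ l) = lastBit-descents false a l

  lastBit-marked : ∀ a l → lastBit false (markLast (descents (a ∷ l))) ≡ true
  lastBit-marked a l rewrite descents-∷ a l = lastBit-markLast false (firstDescent a l) (descents l)

  P≈descentSum : ∀ n → P n x y z w ≈ descentSum n weightP
  P≈descentSum n = Σl-cong∈ (perms n) (λ mem → reflexive (summand mem))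
    where
    summand : ∀ {π} → π ∈ perms n →
      monomial (extPk π) (pdd π) (extPk π ℕ.+ 1) (n ∸ (2 ℕ.* extPk π ℕ.+ pdd π)) ≡ weightP (descents π)
    summand {π} mem with perms-⁻ n π mem
    ... | u , len , _ rewrite extPk≡peaks π (unique⇒adjacentDistinct π u) | pdd≡doubleDescents π =
      ≡.cong (monomial (peaks d) (doubleDescents d) (peaks d ℕ.+ 1))
             (≡.trans (≡.cong (_∸ (2 ℕ.* peaks d ℕ.+ doubleDescents d)) length+0) (doubleAscents-exponent d))
      where
      d = descents π
      length+0 : n ≡ length (descents π) ℕ.+ b2n (lastBit false (descents π))
      length+0 rewrite lastBit-descents-false π | ℕP.+-identityʳ (length (descents π)) | length-descents π = ≡.sym len

  Q≈descentSum : ∀ m → Q (suc m) x y z w ≈ descentSum (suc m) weightQ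
  Q≈descentSum m = Σl-cong∈ (perms (suc m)) (λ mem → reflexive (summand mem))
    where
    summand : ∀ {π} → π ∈ perms (suc m) →
      monomial (pk π) (dd π) (pk π) ((suc m ℕ.+ 1) ∸ (2 ℕ.* pk π ℕ.+ dd π)) ≡ weightQ (descents π)
    summand {π} mem with perms-⁻ (suc m) π mem
    summand {[]}    mem | _ , () , _
    summand {a ∷ l} mem | u , len , all
      rewrite pk≡peaks (a ∷ l) (unique⇒adjacentDistinct (a ∷ l) u) (inRange⇒positive (a ∷ l) all)
            | dd≡doubleDescents (a ∷ l) (inRange⇒positive (a ∷ l) all) =
      ≡.cong (monomial (peaks v) (doubleDescents v) (peaks v))
             (≡.trans (≡.cong (_∸ (2 ℕ.* peaks v ℕ.+ doubleDescents v)) length+1) (doubleAscents-exponent v))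
      where
      v = markLast (descents (a ∷ l))
      length+1 : suc m ℕ.+ 1 ≡ length v ℕ.+ b2n (lastBit false v)
      length+1 rewrite lastBit-marked a l | length-markLast-descents (a ∷ l) = ≡.cong (ℕ._+ 1) (≡.sym len)

  -- Putting 1 first adds a leading ascent: one more double ascent.
  weightP-ascent : ∀ u → weightP (false ∷ u) ≈ w * weightP u
  weightP-ascent u = x∙yz≈y∙xz _ w _

  weight-cut : ∀ a σ τ → All (1 ℕ.<_) (a ∷ σ) → All (1 ℕ.<_) τ →
    weightP (descents ((a ∷ σ) ++ 1 ∷ τ)) ≈ weightQ (descents (a ∷ σ)) * weightP (descents τ)
  weight-cut a σ τ σ>1 τ>1 = begin
    weightP (descents ((a ∷ σ) ++ 1 ∷ τ))
      ≡⟨ ≡.cong weightP (descents-cut a σ τ σ>1 τ>1) ⟩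
    weightP (V ++ false ∷ T)
      ≡⟨ ≡.cong₂ (λ p q → monomial p q (p ℕ.+ 1) (doubleAscents (V ++ false ∷ T))) (additive peakPat ≡.refl) (additive ddPat ≡.refl) ⟩
    monomial (peaks V ℕ.+ peaks T) (doubleDescents V ℕ.+ doubleDescents T)
             (peaks V ℕ.+ peaks T ℕ.+ 1) (doubleAscents (V ++ false ∷ T))
      ≡⟨ ≡.cong₂ (monomial (peaks V ℕ.+ peaks T) (doubleDescents V ℕ.+ doubleDescents T))
                 (ℕP.+-assoc (peaks V) (peaks T) 1) (additive daPat ≡.refl) ⟩
    monomial (peaks V ℕ.+ peaks T) (doubleDescents V ℕ.+ doubleDescents T)
             (peaks V ℕ.+ (peaks T ℕ.+ 1)) (doubleAscents V ℕ.+ doubleAscents T)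
      ≈⟨ monomial-+ (peaks V) (doubleDescents V) (peaks V) (doubleAscents V)
                   (peaks T) (doubleDescents T) (peaks T ℕ.+ 1) (doubleAscents T) ⟩
    weightQ (descents (a ∷ σ)) * weightP T ∎
    where
    V = markLast (descents (a ∷ σ))
    T = descents τ
    additive : ∀ p → p true false ≡ false → countPat p false (V ++ false ∷ T) ≡ countPat p false V ℕ.+ countPat p false T
    additive p p-cut = countPat-cut p p-cut false V T (lastBit-marked a σ)

  weight-insert-after : ∀ n ρ → ρ ∈ perms n → ∀ i → i < n →
    weightP (descents (insertAt (suc i) 1 (map suc ρ))) ≈ splitWeight (suc i) weightQ weightP ρ
  weight-insert-after n []      mem i i<n = ⊥-elim (ℕP.n≮0 (≡.subst (i <_) (≡.sym (perm-length n mem)) i<n))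
  weight-insert-after n (r ∷ ρ) mem i _   = begin
    weightP (descents (insertAt (suc i) 1 s))
      ≡⟨ ≡.cong (weightP ∘ descents) (insertAt-split (suc i) 1 s) ⟩
    weightP (descents ((suc r ∷ take i (map suc ρ)) ++ 1 ∷ drop (suc i) s))
      ≈⟨ weight-cut (suc r) (take i (map suc ρ)) (drop (suc i) s) (AllP.take⁺ (suc i) s>1) (AllP.drop⁺ (suc i) s>1) ⟩
    weightQ (descents (take (suc i) s)) * weightP (descents (drop (suc i) s))
      ≡⟨ ≡.cong₂ (λ a b → weightQ a * weightP b) (descents-take-shifted (suc i) (r ∷ ρ)) (descents-drop-shifted (suc i) (r ∷ ρ)) ⟩
    splitWeight (suc i) weightQ weightP (r ∷ ρ) ∎
    where
    s = map suc (r ∷ ρ)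
    s>1 = shifted>1 (r ∷ ρ) (perm-inRange n mem)

  weight-insertions : ∀ n {ρ} → ρ ∈ perms n →
    Σr (suc n) (λ j → weightP (descents (insertAt j 1 (map suc ρ))))
      ≈ w * weightP (descents ρ) + Σr n (λ i → splitWeight (suc i) weightQ weightP ρ)
  weight-insertions n {ρ} mem = +-cong first (Σr-cong n (weight-insert-after n ρ mem))
    where
    first : weightP (descents (1 ∷ map suc ρ)) ≈ w * weightP (descents ρ)
    first = trans (reflexive (≡.cong weightP (descents-insertOne 0 ρ (perm-inRange n mem) z≤n)))
                  (weightP-ascent (descents ρ))

  P-suc-by-cuts : ∀ n →
    P (suc n) x y z w ≈ w * P n x y z w + Σr n (λ i → Σl (splitWeight (suc i) weightQ weightP) (perms n))
  P-suc-by-cuts n = begin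
    P (suc n) x y z w
      ≈⟨ P≈descentSum (suc n) ⟩
    descentSum (suc n) weightP
      ≈⟨ Σ-perms-suc n (weightP ∘ descents) ⟩
    Σl (λ ρ → Σr (suc n) (λ j → weightP (descents (insertAt j 1 (map suc ρ))))) (perms n)
      ≈⟨ Σl-cong∈ (perms n) (weight-insertions n) ⟩
    Σl (λ ρ → w * weightP (descents ρ) + Σr n (λ i → cut i ρ)) (perms n)
      ≈⟨ Σl-+ (λ ρ → w * weightP (descents ρ)) (λ ρ → Σr n (λ i → cut i ρ)) (perms n) ⟩
    Σl (λ ρ → w * weightP (descents ρ)) (perms n) + Σl (λ ρ → Σr n (λ i → cut i ρ)) (perms n)
      ≈⟨ +-cong (Σl-*ˡ w (weightP ∘ descents) (perms n)) (Σl-Σr n (λ ρ i → cut i ρ) (perms n)) ⟩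
    w * descentSum n weightP + Σr n (λ i → Σl (cut i) (perms n))
      ≈⟨ +-congʳ (*-congˡ (sym (P≈descentSum n))) ⟩
    w * P n x y z w + Σr n (λ i → Σl (cut i) (perms n)) ∎
    where
    cut : ℕ → List ℕ → Carrier
    cut i = splitWeight (suc i) weightQ weightP

-- P_{n+1} = w·P_n + Σ_{i<n} Σ_ρ weightQ(ρ₁⋯ρ_{i+1})·weightP(rest) by the position
-- of 1; the shuffle lemma evaluates each inner sum as C(n,i+1)·Q_{i+1}·P_{n-i-1},
-- and reversing the order of summation gives the stated form.
theorem2p3 : ∀ {c ℓ} (R : CommutativeSemiring c ℓ) →
    let open CommutativeSemiring R
        open Poly R
    in ∀ (n : ℕ) (x y z w : Carrier) →
      P (suc n) x y z w
        ≈ w * P n x y z w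
          + Σ< n (λ k → nat (n C k) * P k x y z w * Q (n ∸ k) x y z w)
theorem2p3 R n x y z w = begin
  P (suc n) x y z w
    ≈⟨ P-suc-by-cuts n ⟩
  w * P n x y z w + Σr n (λ i → Σl (splitWeight (suc i) weightQ weightP) (perms n))
    ≈⟨ +-congˡ (Σr-cong n (λ i i<n → shuffle n (suc i) i<n weightQ weightP)) ⟩
  w * P n x y z w + Σr n (λ i → nat (n C suc i) * (descentSum (suc i) weightQ * descentSum (n ∸ suc i) weightP))
    ≈⟨ +-congˡ (Σr-cong n (λ i _ → *-congˡ (*-cong (sym (Q≈descentSum i)) (sym (P≈descentSum (n ∸ suc i)))))) ⟩
  w * P n x y z w + Σr n (λ i → nat (n C suc i) * (Q (suc i) x y z w * P (n ∸ suc i) x y z w))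
    ≈⟨ +-congˡ (sym (Σ<-binomial-reverse n (λ k → P k x y z w) (λ k → Q k x y z w))) ⟩
  w * P n x y z w + Σ< n (λ k → nat (n C k) * P k x y z w * Q (n ∸ k) x y z w) ∎
  where
  open CommutativeSemiring R
  open Poly R
  open Sums R
  open DescentSums R
  open Weights R x y z w
  open import Relation.Binary.Reasoning.Setoid setoid
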